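{- Let $d\ge2$. A $d$-combining tree-child network with $n$ leaves and $k$ reticulation nodes has exactly $n-k-1$ free tree nodes and thus exactly $2(n-k-1)$ free edges.
   Context: A (rooted) phylogenetic network with $n$ leaves is a simple directed acyclic graph with no nodes of in-degree $1$ and out-degree $1$, a unique node of in-degree $0$ and out-degree $1$ (the root), and exactly $n$ nodes of in-degree $1$ and out-degree $0$ (the leaves), bijectively labeled by $\{1,\ldots,n\}$. For a fixed integer $d\ge 2$, such a network is $d$-combining if every internal node has either in-degree $1$ and out-degree $2$ (a tree node) or in-degree $d$ and out-degree $1$ (a reticulation node). A $d$-combining network is tree-child if every non-leaf node has at least one child that is not a reticulation node. A tree node is free if neither of its two children is a reticulation node; the two edges from a free tree node to its children are called free edges. -}

module Defs where

open import Data.Nat using (ℕ; zero; suc; _+_; _≡ᵇ_)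
open import Data.Fin using (Fin; zero; suc)
open import Data.Bool using (Bool; true; false; if_then_else_; _∧_; not)
open import Data.Product using (Σ; _×_; ∃; ∃-syntax)
open import Data.Sum using (_⊎_)
open import Relation.Binary.PropositionalEquality using (_≡_)
open import Relation.Nullary using (¬_)

sumFin : ∀ {m} → (Fin m → ℕ) → ℕ
sumFin {zero} f = 0
sumFin {suc m} f = f zero + sumFin (λ i → f (suc i))

count : ∀ {m} → (Fin m → Bool) → ℕ
count f = sumFin (λ i → if f i then 1 else 0)

allFinᵇ : ∀ {m} → (Fin m → Bool) → Bool
allFinᵇ {zero} f = true
allFinᵇ {suc m} f = f zero ∧ allFinᵇ (λ i → f (suc i))

-- A finite simple directed graph on node set Fin m: E u v ≡ true iff (u,v) is an edge.
-- (Bool-valued adjacency: no multi-edges; loops excluded by acyclicity below.)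
Adj : ℕ → Set
Adj m = Fin m → Fin m → Bool

module _ {m : ℕ} (E : Adj m) where
  indeg : Fin m → ℕ
  indeg v = count (λ u → E u v)

  outdeg : Fin m → ℕ
  outdeg v = count (λ w → E v w)

  data Path : Fin m → Fin m → Set where
    edge : ∀ {u v} → E u v ≡ true → Path u v
    step : ∀ {u v w} → E u v ≡ true → Path v w → Path u w

  Acyclic : Set
  Acyclic = ∀ v → ¬ Path v v

  isRootᵇ : Fin m → Bool
  isRootᵇ v = (indeg v ≡ᵇ 0) ∧ (outdeg v ≡ᵇ 1)

  isLeafᵇ : Fin m → Bool
  isLeafᵇ v = (indeg v ≡ᵇ 1) ∧ (outdeg v ≡ᵇ 0)

  isTreeᵇ : Fin m → Bool
  isTreeᵇ v = (indeg v ≡ᵇ 1) ∧ (outdeg v ≡ᵇ 2)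

  isRetᵇ : ℕ → Fin m → Bool
  isRetᵇ d v = (indeg v ≡ᵇ d) ∧ (outdeg v ≡ᵇ 1)

  isFreeᵇ : ℕ → Fin m → Bool
  isFreeᵇ d v = isTreeᵇ v ∧ allFinᵇ (λ w → not (E v w ∧ isRetᵇ d w))

record Network (d n m : ℕ) : Set where
  field
    E        : Adj m
    acyclic  : Acyclic E
    root     : Fin m
    root-deg : isRootᵇ E root ≡ true
    root-unique : ∀ v → indeg E v ≡ 0 → v ≡ root
    leaf     : Fin n → Fin m
    leaf-deg : ∀ i → isLeafᵇ E (leaf i) ≡ true
    leaf-inj : ∀ i j → leaf i ≡ leaf j → i ≡ j
    leaf-surj : ∀ v → isLeafᵇ E v ≡ true → ∃[ i ] leaf i ≡ v
    -- every node is the root, a leaf, a tree node (1,2) or a reticulation node (d,1)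
    -- (in particular no node has in-degree 1 and out-degree 1)
    node-type : ∀ v → isRootᵇ E v ≡ true ⊎ isLeafᵇ E v ≡ true
                      ⊎ isTreeᵇ E v ≡ true ⊎ isRetᵇ E d v ≡ true

module _ {d n m : ℕ} (N : Network d n m) where
  open Network N

  TreeChild : Set
  TreeChild = ∀ v → ¬ (isLeafᵇ E v ≡ true) →
              ∃[ w ] (E v w ≡ true × isRetᵇ E d w ≡ false)

  reticulationCount : ℕ
  reticulationCount = count (isRetᵇ E d)

  freeTreeNodeCount : ℕ
  freeTreeNodeCount = count (isFreeᵇ E d)

  freeEdgeCount : ℕ
  freeEdgeCount = sumFin (λ u → count (λ w → isFreeᵇ E d u ∧ E u w))

-- Count the edges of the network twice. Summing out-degrees gives 1 + 2t + k and summing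
-- in-degrees gives n + t + dk, where t is the number of tree nodes. In a tree-child network
-- every parent of a reticulation is a tree node with exactly one reticulation child, so the
-- non-free tree nodes are in bijection with the dk edges entering reticulations: t = f + dk.
-- Eliminating t yields f + k + 1 = n, and each free tree node has exactly two free edges.
module Submission where

open import Defs
open import Data.Bool using (Bool; true; false; if_then_else_; _∧_; not)
open import Data.Bool.Properties using (∧-comm; ¬-not; T-≡; T-∧)
open import Data.Fin using (Fin; zero; suc; _≟_)
open import Data.Fin.Properties using (suc-injective)
open import Data.Nat using (ℕ; zero; suc; _+_; _*_; _∸_; _≤_; z≤n; s≤s; _≡ᵇ_)
open import Data.Nat.Properties
  using (+-*-semiring; +-identityʳ; *-identityʳ; *-zeroʳ; *-comm; +-assoc; +-cancelʳ-≡;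
         ∸-+-assoc; m+n∸n≡m; m+n≤o⇒m≤o∸n; +-monoʳ-≤; m+n≡0⇒m≡0; n≤0⇒n≡0; ≡ᵇ⇒≡; ≡⇒≡ᵇ)
open import Data.Nat.Solver using (module +-*-Solver)
open import Data.Product using (_×_; _,_; proj₁; proj₂; ∃-syntax)
open import Data.Sum using (_⊎_; inj₁; inj₂)
open import Function using (_∘_; Equivalence)
open import Relation.Nullary using (contradiction; does; yes)
open import Relation.Nullary.Decidable using (dec-true; dec-false)
open import Relation.Binary.PropositionalEquality
open ≡-Reasoning
open Equivalence using (to; from)
open import Algebra.Properties.Semiring.Sum +-*-semiring
  using (sum; ∑-distrib-+; ∑-comm; *-distribˡ-sum; sum-cong-≗)

sumFin≡sum : ∀ {m} (f : Fin m → ℕ) → sumFin f ≡ sum f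
sumFin≡sum {zero}  f = refl
sumFin≡sum {suc m} f = cong (f zero +_) (sumFin≡sum (f ∘ suc))

sumFin-cong : ∀ {m} {f g : Fin m → ℕ} → (∀ i → f i ≡ g i) → sumFin f ≡ sumFin g
sumFin-cong {f = f} {g} f≗g = begin
  sumFin f  ≡⟨ sumFin≡sum f ⟩
  sum f     ≡⟨ sum-cong-≗ f≗g ⟩
  sum g     ≡⟨ sumFin≡sum g ⟨
  sumFin g  ∎

sumFin-distrib-+ : ∀ {m} (f g : Fin m → ℕ) → sumFin (λ i → f i + g i) ≡ sumFin f + sumFin g
sumFin-distrib-+ f g = begin
  sumFin (λ i → f i + g i)  ≡⟨ sumFin≡sum (λ i → f i + g i) ⟩
  sum (λ i → f i + g i)     ≡⟨ ∑-distrib-+ f g ⟩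
  sum f + sum g             ≡⟨ cong₂ _+_ (sumFin≡sum f) (sumFin≡sum g) ⟨
  sumFin f + sumFin g       ∎

sumFin-*ˡ : ∀ {m} c (f : Fin m → ℕ) → sumFin (λ i → c * f i) ≡ c * sumFin f
sumFin-*ˡ c f = begin
  sumFin (λ i → c * f i)  ≡⟨ sumFin≡sum (λ i → c * f i) ⟩
  sum (λ i → c * f i)     ≡⟨ *-distribˡ-sum c f ⟨
  c * sum f               ≡⟨ cong (c *_) (sumFin≡sum f) ⟨
  c * sumFin f            ∎

sumFin-comm : ∀ {m p} (f : Fin m → Fin p → ℕ) →
              sumFin (λ i → sumFin (f i)) ≡ sumFin (λ j → sumFin (λ i → f i j))
sumFin-comm f = begin
  sumFin (λ i → sumFin (f i))            ≡⟨ sumFin-cong (λ i → sumFin≡sum (f i)) ⟩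
  sumFin (λ i → sum (f i))               ≡⟨ sumFin≡sum (λ i → sum (f i)) ⟩
  sum (λ i → sum (f i))                  ≡⟨ ∑-comm f ⟩
  sum (λ j → sum (λ i → f i j))          ≡⟨ sumFin≡sum (λ j → sum (λ i → f i j)) ⟨
  sumFin (λ j → sum (λ i → f i j))       ≡⟨ sumFin-cong (λ j → sumFin≡sum (λ i → f i j)) ⟨
  sumFin (λ j → sumFin (λ i → f i j))    ∎

ι : Bool → ℕ
ι b = if b then 1 else 0

ι-*-cong : ∀ b {x y} → (b ≡ true → x ≡ y) → ι b * x ≡ ι b * y
ι-*-cong true  x≡y = cong (_+ 0) (x≡y refl)
ι-*-cong false _   = refl

count-false : ∀ {m} (P : Fin m → Bool) → (∀ x → P x ≡ false) → count P ≡ 0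
count-false {zero}  P _ = refl
count-false {suc m} P P≡false rewrite P≡false zero = count-false (P ∘ suc) (P≡false ∘ suc)

count-unique : ∀ {m} (P : Fin m → Bool) {a} → P a ≡ true → (∀ x → P x ≡ true → x ≡ a) → count P ≡ 1
count-unique P {zero} Pa≡true unique rewrite Pa≡true =
  cong suc (count-false (P ∘ suc) (λ x → ¬-not λ P[1+x] → contradiction (unique (suc x) P[1+x]) λ ()))
count-unique P {suc a} Pa≡true unique rewrite ¬-not {P zero} λ P0 → contradiction (unique zero P0) λ () =
  count-unique (P ∘ suc) Pa≡true (λ x P[1+x] → suc-injective (unique (suc x) P[1+x]))

count-pos : ∀ {m} (P : Fin m → Bool) {a} → P a ≡ true → 1 ≤ count P
count-pos P {zero}  Pa≡true rewrite Pa≡true = s≤s z≤n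
count-pos P {suc a} Pa≡true with P zero
... | true  = s≤s z≤n
... | false = count-pos (P ∘ suc) Pa≡true

count-split : ∀ {m} (P Q : Fin m → Bool) → count P ≡ count (λ w → P w ∧ Q w) + count (λ w → P w ∧ not (Q w))
count-split P Q = trans (sumFin-cong split) (sumFin-distrib-+ (λ w → ι (P w ∧ Q w)) (λ w → ι (P w ∧ not (Q w))))
  where
  split : ∀ w → ι (P w) ≡ ι (P w ∧ Q w) + ι (P w ∧ not (Q w))
  split w with P w | Q w
  ... | true  | true  = refl
  ... | true  | false = refl
  ... | false | _     = refl

count-const-∧ : ∀ {m} b (P : Fin m → Bool) → count (λ w → b ∧ P w) ≡ ι b * count P
count-const-∧ true  P = sym (+-identityʳ (count P))
count-const-∧ {m} false P = count-false {m} (λ _ → false) (λ _ → refl)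

allFinᵇ-not : ∀ {m} (P : Fin m → Bool) → allFinᵇ (λ w → not (P w)) ≡ (count P ≡ᵇ 0)
allFinᵇ-not {zero}  P = refl
allFinᵇ-not {suc m} P with P zero
... | true  = refl
... | false = allFinᵇ-not (P ∘ suc)

count-true : ∀ m → count {m} (λ _ → true) ≡ m
count-true zero    = refl
count-true (suc m) = cong suc (count-true m)

count-image : ∀ {n m} (P : Fin m → Bool) (f : Fin n → Fin m) →
              (∀ i j → f i ≡ f j → i ≡ j) → (∀ i → P (f i) ≡ true) →
              (∀ v → P v ≡ true → ∃[ i ] f i ≡ v) → count P ≡ n
count-image {n} {m} P f f-injective P∘f P⇒image = begin
  count P                                ≡⟨ sumFin-cong (λ v → sym (fibre-size v)) ⟩
  sumFin (λ v → count (λ i → hits i v))  ≡⟨ sumFin-comm (λ v i → ι (hits i v)) ⟩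
  sumFin (λ i → count (hits i))          ≡⟨ sumFin-cong (λ i → count-unique (hits i) (dec-true (f i ≟ f i) refl)
                                                                        (hit⇒≡ i)) ⟩
  count {n} (λ _ → true)                 ≡⟨ count-true n ⟩
  n                                      ∎
  where
  hits : Fin n → Fin m → Bool
  hits i v = does (f i ≟ v)

  hit⇒≡ : ∀ i v → does (f i ≟ v) ≡ true → v ≡ f i
  hit⇒≡ i v hit with f i ≟ v | hit
  ... | yes fi≡v | _ = sym fi≡v

  fibre-size : ∀ v → count (λ i → hits i v) ≡ ι (P v)
  fibre-size v with P v in Pv
  ... | true  = let i , fi≡v = P⇒image v Pv in
    count-unique (λ j → hits j v) (dec-true (f i ≟ v) fi≡v)
                 (λ j hit → f-injective j i (trans (sym (hit⇒≡ j v hit)) (sym fi≡v)))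
  ... | false = count-false (λ i → hits i v) (λ i → dec-false (f i ≟ v) (miss i))
    where
    miss : ∀ i → f i ≢ v
    miss i fi≡v = contradiction (trans (sym Pv) (subst (λ u → P u ≡ true) fi≡v (P∘f i))) λ ()

sumFin-linear : ∀ {m} a b c (P Q R : Fin m → Bool) →
                sumFin (λ v → a * ι (P v) + b * ι (Q v) + c * ι (R v)) ≡ a * count P + b * count Q + c * count R
sumFin-linear a b c P Q R = begin
  sumFin (λ v → a * ι (P v) + b * ι (Q v) + c * ι (R v))
    ≡⟨ sumFin-distrib-+ (λ v → a * ι (P v) + b * ι (Q v)) (λ v → c * ι (R v)) ⟩
  sumFin (λ v → a * ι (P v) + b * ι (Q v)) + sumFin (λ v → c * ι (R v))
    ≡⟨ cong (_+ sumFin (λ v → c * ι (R v))) (sumFin-distrib-+ (λ v → a * ι (P v)) (λ v → b * ι (Q v))) ⟩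
  sumFin (λ v → a * ι (P v)) + sumFin (λ v → b * ι (Q v)) + sumFin (λ v → c * ι (R v))
    ≡⟨ cong₂ _+_ (cong₂ _+_ (sumFin-*ˡ a (ι ∘ P)) (sumFin-*ˡ b (ι ∘ Q))) (sumFin-*ˡ c (ι ∘ R)) ⟩
  a * count P + b * count Q + c * count R  ∎

handshake : ∀ {m} (E : Adj m) → sumFin (outdeg E) ≡ sumFin (indeg E)
handshake E = sumFin-comm (λ v w → ι (E v w))

∧-trueˡ : ∀ {a b} → a ∧ b ≡ true → a ≡ true
∧-trueˡ {true} _ = refl

≡ᵇ-refl : ∀ n → (n ≡ᵇ n) ≡ true
≡ᵇ-refl n = to T-≡ (≡⇒≡ᵇ n n refl)

≡ᵇ-∧-≡ᵇ⇒≡ : ∀ i o a b → ((i ≡ᵇ a) ∧ (o ≡ᵇ b)) ≡ true → i ≡ a × o ≡ b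
≡ᵇ-∧-≡ᵇ⇒≡ i o a b p = let i≡ᵇa , o≡ᵇb = to T-∧ (from T-≡ p) in
  ≡ᵇ⇒≡ i a i≡ᵇa , ≡ᵇ⇒≡ o b o≡ᵇb

data NodeType (d : ℕ) : ℕ → ℕ → Set where
  root-node         : NodeType d 0 1
  leaf-node         : NodeType d 1 0
  tree-node         : NodeType d 1 2
  reticulation-node : NodeType d d 1

nodeType : ∀ {d i o} →
           ((i ≡ᵇ 0) ∧ (o ≡ᵇ 1)) ≡ true ⊎ ((i ≡ᵇ 1) ∧ (o ≡ᵇ 0)) ≡ true ⊎
           ((i ≡ᵇ 1) ∧ (o ≡ᵇ 2)) ≡ true ⊎ ((i ≡ᵇ d) ∧ (o ≡ᵇ 1)) ≡ true → NodeType d i o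
nodeType {d} {i} {o} (inj₁ p) with ≡ᵇ-∧-≡ᵇ⇒≡ i o 0 1 p
... | refl , refl = root-node
nodeType {d} {i} {o} (inj₂ (inj₁ p)) with ≡ᵇ-∧-≡ᵇ⇒≡ i o 1 0 p
... | refl , refl = leaf-node
nodeType {d} {i} {o} (inj₂ (inj₂ (inj₁ p))) with ≡ᵇ-∧-≡ᵇ⇒≡ i o 1 2 p
... | refl , refl = tree-node
nodeType {d} {i} {o} (inj₂ (inj₂ (inj₂ p))) with ≡ᵇ-∧-≡ᵇ⇒≡ i o d 1 p
... | refl , refl = reticulation-node

outdeg-by-type : ∀ {e i o} → NodeType (2 + e) i o →
  o ≡ 1 * ι ((i ≡ᵇ 0) ∧ (o ≡ᵇ 1)) + 2 * ι ((i ≡ᵇ 1) ∧ (o ≡ᵇ 2)) + 1 * ι ((i ≡ᵇ 2 + e) ∧ (o ≡ᵇ 1))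
outdeg-by-type root-node = refl
outdeg-by-type leaf-node = refl
outdeg-by-type tree-node = refl
outdeg-by-type {e} reticulation-node rewrite ≡ᵇ-refl e = refl

indeg-by-type : ∀ {e i o} → NodeType (2 + e) i o →
  i ≡ 1 * ι ((i ≡ᵇ 1) ∧ (o ≡ᵇ 0)) + 1 * ι ((i ≡ᵇ 1) ∧ (o ≡ᵇ 2)) + (2 + e) * ι ((i ≡ᵇ 2 + e) ∧ (o ≡ᵇ 1))
indeg-by-type {e} root-node = sym (*-zeroʳ (2 + e))
indeg-by-type {e} leaf-node = cong suc (sym (*-zeroʳ (2 + e)))
indeg-by-type {e} tree-node = cong suc (sym (*-zeroʳ (2 + e)))
indeg-by-type {e} reticulation-node rewrite ≡ᵇ-refl e = sym (*-identityʳ (2 + e))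

-- c counts the reticulation children; a tree node is free exactly when c = 0.
tree-by-type : ∀ {e i o c} → NodeType (2 + e) i o → c ≤ o ∸ 1 →
  ι ((i ≡ᵇ 1) ∧ (o ≡ᵇ 2)) ≡ ι (((i ≡ᵇ 1) ∧ (o ≡ᵇ 2)) ∧ (c ≡ᵇ 0)) + c
tree-by-type root-node         c≤0 = sym (n≤0⇒n≡0 c≤0)
tree-by-type leaf-node         c≤0 = sym (n≤0⇒n≡0 c≤0)
tree-by-type reticulation-node c≤0 = sym (n≤0⇒n≡0 c≤0)
tree-by-type tree-node z≤n       = refl
tree-by-type tree-node (s≤s z≤n) = refl

≤∸1-of-split : ∀ {c r o} → c + r ≡ o → o ≡ 0 ⊎ 1 ≤ r → c ≤ o ∸ 1
≤∸1-of-split {c} c+r≡o (inj₁ o≡0) = subst (_≤ _) (sym (m+n≡0⇒m≡0 c (trans c+r≡o o≡0))) z≤n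
≤∸1-of-split {c} c+r≡o (inj₂ 1≤r) = m+n≤o⇒m≤o∸n c (subst (c + 1 ≤_) c+r≡o (+-monoʳ-≤ c 1≤r))

-- The handshake identity 1 + 2t + k = n + t + dk with t = f + D and D = dk, in the shape produced by sumFin-linear.
eliminate-tree-nodes : ∀ f k D n → 1 * 1 + 2 * (f + D) + 1 * k ≡ 1 * n + 1 * (f + D) + D → f + k + 1 ≡ n
eliminate-tree-nodes f k D n handshake-eq = +-cancelʳ-≡ (f + D + D) (f + k + 1) n (begin
  f + k + 1 + (f + D + D)      ≡⟨ lhs f k D ⟩
  1 * 1 + 2 * (f + D) + 1 * k  ≡⟨ handshake-eq ⟩
  1 * n + 1 * (f + D) + D      ≡⟨ rhs n f D ⟩
  n + (f + D + D)              ∎)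
  where
  open +-*-Solver
  lhs : ∀ f k D → f + k + 1 + (f + D + D) ≡ 1 * 1 + 2 * (f + D) + 1 * k
  lhs = solve 3 (λ f k D → f :+ k :+ con 1 :+ (f :+ D :+ D) := con 1 :* con 1 :+ con 2 :* (f :+ D) :+ con 1 :* k) refl
  rhs : ∀ n f D → 1 * n + 1 * (f + D) + D ≡ n + (f + D + D)
  rhs = solve 3 (λ n f D → con 1 :* n :+ con 1 :* (f :+ D) :+ D := n :+ (f :+ D :+ D)) refl

m+n+1∸n∸1≡m : ∀ m n → m + n + 1 ∸ n ∸ 1 ≡ m
m+n+1∸n∸1≡m m n = begin
  m + n + 1 ∸ n ∸ 1    ≡⟨ ∸-+-assoc (m + n + 1) n 1 ⟩
  m + n + 1 ∸ (n + 1)  ≡⟨ cong (_∸ (n + 1)) (+-assoc m n 1) ⟩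
  m + (n + 1) ∸ (n + 1) ≡⟨ m+n∸n≡m m (n + 1) ⟩
  m                    ∎

module TreeChildCounts {e n m} (N : Network (2 + e) n m) (tree-child : TreeChild N) where
  open Network N

  t k f : ℕ
  t = count (isTreeᵇ E)
  k = reticulationCount N
  f = freeTreeNodeCount N

  reticulationChildren : Fin m → ℕ
  reticulationChildren v = count (λ w → E v w ∧ isRetᵇ E (2 + e) w)

  type : ∀ v → NodeType (2 + e) (indeg E v) (outdeg E v)
  type v = nodeType (node-type v)

  count-root : count (isRootᵇ E) ≡ 1
  count-root = count-unique (isRootᵇ E) root-deg
    (λ v rootᵥ → root-unique v (proj₁ (≡ᵇ-∧-≡ᵇ⇒≡ (indeg E v) (outdeg E v) 0 1 rootᵥ)))

  count-leaf : count (isLeafᵇ E) ≡ n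
  count-leaf = count-image (isLeafᵇ E) leaf leaf-inj leaf-deg leaf-surj

  sum-outdeg : sumFin (outdeg E) ≡ 1 * 1 + 2 * t + 1 * k
  sum-outdeg = begin
    sumFin (outdeg E)
      ≡⟨ sumFin-cong (λ v → outdeg-by-type (type v)) ⟩
    sumFin (λ v → 1 * ι (isRootᵇ E v) + 2 * ι (isTreeᵇ E v) + 1 * ι (isRetᵇ E (2 + e) v))
      ≡⟨ sumFin-linear 1 2 1 (isRootᵇ E) (isTreeᵇ E) (isRetᵇ E (2 + e)) ⟩
    1 * count (isRootᵇ E) + 2 * t + 1 * k
      ≡⟨ cong (λ r → 1 * r + 2 * t + 1 * k) count-root ⟩
    1 * 1 + 2 * t + 1 * k  ∎

  sum-indeg : sumFin (indeg E) ≡ 1 * n + 1 * t + (2 + e) * k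
  sum-indeg = begin
    sumFin (indeg E)
      ≡⟨ sumFin-cong (λ v → indeg-by-type (type v)) ⟩
    sumFin (λ v → 1 * ι (isLeafᵇ E v) + 1 * ι (isTreeᵇ E v) + (2 + e) * ι (isRetᵇ E (2 + e) v))
      ≡⟨ sumFin-linear 1 1 (2 + e) (isLeafᵇ E) (isTreeᵇ E) (isRetᵇ E (2 + e)) ⟩
    1 * count (isLeafᵇ E) + 1 * t + (2 + e) * k
      ≡⟨ cong (λ l → 1 * l + 1 * t + (2 + e) * k) count-leaf ⟩
    1 * n + 1 * t + (2 + e) * k  ∎

  -- Truncated subtraction makes this hold for leaves as well, where both sides are 0.
  reticulationChildren≤outdeg∸1 : ∀ v → reticulationChildren v ≤ outdeg E v ∸ 1
  reticulationChildren≤outdeg∸1 v = ≤∸1-of-split (sym (count-split (E v) (isRetᵇ E (2 + e)))) leaf-or-parent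
    where
    leaf-or-parent : outdeg E v ≡ 0 ⊎ 1 ≤ count (λ w → E v w ∧ not (isRetᵇ E (2 + e) w))
    leaf-or-parent with isLeafᵇ E v in leafᵥ
    ... | true  = inj₁ (proj₂ (≡ᵇ-∧-≡ᵇ⇒≡ (indeg E v) (outdeg E v) 1 0 leafᵥ))
    ... | false with tree-child v (λ leafᵥ′ → contradiction (trans (sym leafᵥ) leafᵥ′) λ ())
    ...   | w , v→w , w-not-ret = inj₂ (count-pos (λ w → E v w ∧ not (isRetᵇ E (2 + e) w)) {w}
                                    (subst₂ (λ a b → a ∧ not b ≡ true) (sym v→w) (sym w-not-ret) refl))

  count-parents-of-reticulation : ∀ w → count (λ v → E v w ∧ isRetᵇ E (2 + e) w) ≡ (2 + e) * ι (isRetᵇ E (2 + e) w)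
  count-parents-of-reticulation w = begin
    count (λ v → E v w ∧ ret)  ≡⟨ sumFin-cong (λ v → cong ι (∧-comm (E v w) ret)) ⟩
    count (λ v → ret ∧ E v w)  ≡⟨ count-const-∧ ret (λ v → E v w) ⟩
    ι ret * indeg E w          ≡⟨ ι-*-cong ret (proj₁ ∘ ≡ᵇ-∧-≡ᵇ⇒≡ (indeg E w) (outdeg E w) (2 + e) 1) ⟩
    ι ret * (2 + e)            ≡⟨ *-comm (ι ret) (2 + e) ⟩
    (2 + e) * ι ret            ∎
    where
    ret : Bool
    ret = isRetᵇ E (2 + e) w

  t≡f+dk : t ≡ f + (2 + e) * k
  t≡f+dk = begin
    t
      ≡⟨ sumFin-cong tree≡free+children ⟩
    sumFin (λ v → ι (isFreeᵇ E (2 + e) v) + reticulationChildren v)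
      ≡⟨ sumFin-distrib-+ (ι ∘ isFreeᵇ E (2 + e)) reticulationChildren ⟩
    f + sumFin reticulationChildren
      ≡⟨ cong (f +_) (sumFin-comm (λ v w → ι (E v w ∧ isRetᵇ E (2 + e) w))) ⟩
    f + sumFin (λ w → count (λ v → E v w ∧ isRetᵇ E (2 + e) w))
      ≡⟨ cong (f +_) (sumFin-cong count-parents-of-reticulation) ⟩
    f + sumFin (λ w → (2 + e) * ι (isRetᵇ E (2 + e) w))
      ≡⟨ cong (f +_) (sumFin-*ˡ (2 + e) (ι ∘ isRetᵇ E (2 + e))) ⟩
    f + (2 + e) * k  ∎
    where
    tree≡free+children : ∀ v → ι (isTreeᵇ E v) ≡ ι (isFreeᵇ E (2 + e) v) + reticulationChildren v
    tree≡free+children v = begin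
      ι (isTreeᵇ E v)
        ≡⟨ tree-by-type (type v) (reticulationChildren≤outdeg∸1 v) ⟩
      ι (isTreeᵇ E v ∧ (reticulationChildren v ≡ᵇ 0)) + reticulationChildren v
        ≡⟨ cong (λ b → ι (isTreeᵇ E v ∧ b) + reticulationChildren v)
                (sym (allFinᵇ-not (λ w → E v w ∧ isRetᵇ E (2 + e) w))) ⟩
      ι (isFreeᵇ E (2 + e) v) + reticulationChildren v  ∎

  f+k+1≡n : f + k + 1 ≡ n
  f+k+1≡n = eliminate-tree-nodes f k ((2 + e) * k) n (begin
    1 * 1 + 2 * (f + (2 + e) * k) + 1 * k      ≡⟨ cong (λ x → 1 * 1 + 2 * x + 1 * k) t≡f+dk ⟨
    1 * 1 + 2 * t + 1 * k                      ≡⟨ sum-outdeg ⟨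
    sumFin (outdeg E)                          ≡⟨ handshake E ⟩
    sumFin (indeg E)                           ≡⟨ sum-indeg ⟩
    1 * n + 1 * t + (2 + e) * k                ≡⟨ cong (λ x → 1 * n + 1 * x + (2 + e) * k) t≡f+dk ⟩
    1 * n + 1 * (f + (2 + e) * k) + (2 + e) * k  ∎)

  freeEdgeCount≡2f : freeEdgeCount N ≡ 2 * f
  freeEdgeCount≡2f = begin
    sumFin (λ u → count (λ w → free u ∧ E u w))  ≡⟨ sumFin-cong (λ u → count-const-∧ (free u) (E u)) ⟩
    sumFin (λ u → ι (free u) * outdeg E u)       ≡⟨ sumFin-cong two-children ⟩
    sumFin (λ u → 2 * ι (free u))                ≡⟨ sumFin-*ˡ 2 (ι ∘ free) ⟩
    2 * f                                        ∎
    where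
    free : Fin m → Bool
    free = isFreeᵇ E (2 + e)
    two-children : ∀ u → ι (free u) * outdeg E u ≡ 2 * ι (free u)
    two-children u = trans
      (ι-*-cong (free u) (λ freeᵤ → proj₂ (≡ᵇ-∧-≡ᵇ⇒≡ (indeg E u) (outdeg E u) 1 2 (∧-trueˡ freeᵤ))))
      (*-comm (ι (free u)) 2)

lemma3p6 : ∀ (d n m k : ℕ) → 2 ≤ d → (N : Network d n m) → TreeChild N →
           reticulationCount N ≡ k →
           (freeTreeNodeCount N + k + 1 ≡ n) × (freeEdgeCount N ≡ 2 * (n ∸ k ∸ 1))
lemma3p6 .(2 + e) n m .(reticulationCount N) (s≤s (s≤s {n = e} z≤n)) N tree-child refl =
  f+k+1≡n , (begin
    freeEdgeCount N          ≡⟨ freeEdgeCount≡2f ⟩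
    2 * f                    ≡⟨ cong (2 *_) (m+n+1∸n∸1≡m f k) ⟨
    2 * (f + k + 1 ∸ k ∸ 1)  ≡⟨ cong (λ x → 2 * (x ∸ k ∸ 1)) f+k+1≡n ⟩
    2 * (n ∸ k ∸ 1)          ∎)
  where open TreeChildCounts N tree-child
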